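{- For any model $M=(W,E,C,\beta)$ and any formula $\phi$, the structure $M^+_\phi=(W,E^+_\phi,C,\beta)$ is a model (over the skill set $\mathsf{S}\cup A_\phi$), i.e. $E^+_\phi$ is symmetric and $E^+_\phi(w,u)=\mathsf{S}\cup A_\phi$ implies $w=u$.
   Context: Fix countably infinite sets $\mathsf{P}$ (atoms), $\mathsf{A}$ (agents), $\mathsf{S}$ (skills). A model is $M=(W,E,C,\beta)$ with $W\neq\emptyset$, $E:W\times W\to\wp(\mathsf{S})$ satisfying symmetry ($E(w,u)=E(u,w)$) and positivity ($E(w,u)=\mathsf{S}$ implies $w=u$), $C:\mathsf{A}\to\wp(\mathsf{S})$, $\beta:W\to\wp(\mathsf{P})$. Formulas are built from atoms with $\neg,\to$, $K_a$, and group operators $C_G,D_G,E_G,F_G$ ($G\subseteq\mathsf{A}$ finite nonempty), possibly with further modal operators. For a formula $\phi$ let $A_\phi$ be the set of groups $G$ such that $E_G$ or $C_G$ occurs in $\phi$; each $G\in A_\phi$ is treated as a new skill, not an element of $\mathsf{S}$. Define, for $w,u\in W$: $E_\phi(w,u)=E(w,u)\cup\{G\in A_\phi\mid \exists a\in G,\ C(a)\subseteq E(w,u)\}$, and $E^+_\phi(w,u)=E_\phi(w,u)\cup\{G\in A_\phi\mid \exists n\ge1\ \exists w_0,\dots,w_n\in W,\ w_0=w,\ w_n=u,\ G\in\bigcap_{0\le i<n}E_\phi(w_i,w_{i+1})\}$. -}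

module Defs where

open import Data.Nat using (ℕ; zero; suc)
open import Data.Fin using (Fin; zero; suc; inject₁; fromℕ)
open import Data.List.NonEmpty using (List⁺; toList)
open import Data.List.Membership.Propositional using (_∈_)
open import Data.Product using (Σ; _×_; ∃-syntax)
open import Data.Sum using (_⊎_; inj₁; inj₂)
open import Data.Unit using (⊤)
open import Relation.Binary.PropositionalEquality using (_≡_)
open import Function.Bundles using (_⇔_)

-- Atoms P, agents A, skills S: all countably infinite, represented by ℕ.
Atom Agent Skill : Set
Atom  = ℕ
Agent = ℕ
Skill = ℕ

Pow : Set → Set₁
Pow X = X → Set

-- A group: a finite nonempty set of agents, presented as a nonempty list.
Group : Set
Group = List⁺ Agent

_∈G_ : Agent → Group → Set
a ∈G G = a ∈ toList G

-- Models M = (W, E, C, β). Set equality is extensional equality of predicates.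
record Model : Set₁ where
  field
    W   : Set
    W-nonempty : W
    E   : W → W → Pow Skill
    C   : Agent → Pow Skill
    β   : W → Pow Atom
    E-sym : ∀ w u s → (E w u s ⇔ E u w s)
    E-pos : ∀ w u → (∀ (s : Skill) → E w u s) → w ≡ u

data Formula : Set where
  atom : Atom → Formula
  ¬'_  : Formula → Formula
  _⇒_  : Formula → Formula → Formula
  K    : Agent → Formula → Formula
  CG DG EG FG : Group → Formula → Formula

data InA : Formula → Group → Set where
  here-C : ∀ {G φ} → InA (CG G φ) G
  here-E : ∀ {G φ} → InA (EG G φ) G
  in-¬   : ∀ {G φ} → InA φ G → InA (¬' φ) G
  in-⇒ˡ  : ∀ {G φ ψ} → InA φ G → InA (φ ⇒ ψ) G
  in-⇒ʳ  : ∀ {G φ ψ} → InA ψ G → InA (φ ⇒ ψ) G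
  in-K   : ∀ {G a φ} → InA φ G → InA (K a φ) G
  in-C   : ∀ {G H φ} → InA φ G → InA (CG H φ) G
  in-D   : ∀ {G H φ} → InA φ G → InA (DG H φ) G
  in-E   : ∀ {G H φ} → InA φ G → InA (EG H φ) G
  in-F   : ∀ {G H φ} → InA φ G → InA (FG H φ) G

-- Extended skill set S ∪ A_φ (groups are new skills, disjoint from S)
ExtSkill : Set
ExtSkill = Skill ⊎ Group

SA : Formula → Pow ExtSkill
SA φ (inj₁ s) = ⊤
SA φ (inj₂ G) = InA φ G

module _ (M : Model) (φ : Formula) where
  open Model M

  Eφ : W → W → Pow ExtSkill
  Eφ w u (inj₁ s) = E w u s
  Eφ w u (inj₂ G) = InA φ G × (∃[ a ] (a ∈G G × (∀ s → C a s → E w u s)))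

  -- ∃ n ≥ 1, w₀ … wₙ with w₀ = w, wₙ = u, G ∈ ⋂_{i<n} E_φ(wᵢ, wᵢ₊₁)
  -- (n = suc m; points indexed by Fin (suc n))
  Chain : Group → W → W → Set
  Chain G w u =
    Σ ℕ λ m → Σ (Fin (suc (suc m)) → W) λ ws →
      (ws zero ≡ w) × (ws (fromℕ (suc m)) ≡ u) ×
      (∀ (i : Fin (suc m)) → Eφ (ws (inject₁ i)) (ws (suc i)) (inj₂ G))

  E⁺φ : W → W → Pow ExtSkill
  E⁺φ w u (inj₁ s) = Eφ w u (inj₁ s)
  E⁺φ w u (inj₂ G) = Eφ w u (inj₂ G) ⊎ (InA φ G × Chain G w u)

module Submission where

-- Symmetry: E_φ is symmetric because E is and C(a) ⊆ E(w,u) only involves E(w,u); a chain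
-- from w to u read backwards is a chain from u to w. Positivity: on the old skills S,
-- E⁺_φ agrees with E, so E⁺_φ(w,u) = S ∪ A_φ forces E(w,u) = S and positivity of E applies.

open import Defs
open import Level using (0ℓ)
open import Data.Nat using (suc)
open import Data.Fin using (Fin; zero; suc; inject₁; fromℕ; opposite)
open import Data.Fin.Properties using (opposite-involutive)
open import Data.Product using (_×_; _,_)
open import Data.Sum using (inj₁; inj₂)
open import Function.Base using (_∘_)
open import Function.Bundles using (_⇔_; mk⇔; Equivalence)
open import Relation.Binary.Core using (Rel)
open import Relation.Binary.Definitions using (Symmetric)
open import Relation.Binary.PropositionalEquality using (_≡_; refl; sym; cong; subst; trans)

opposite-fromℕ : ∀ n → opposite (fromℕ n) ≡ zero
opposite-fromℕ n = opposite-involutive {suc n} zero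

opposite-inject₁ : ∀ {n} (i : Fin n) → opposite (inject₁ i) ≡ suc (opposite i)
opposite-inject₁ {suc n} zero    = refl
opposite-inject₁ {suc n} (suc i) = cong inject₁ (opposite-inject₁ i)

IsPath : ∀ {X : Set} → Rel X 0ℓ → ∀ {n} → (Fin (suc n) → X) → Set
IsPath R {n} ws = ∀ (i : Fin n) → R (ws (inject₁ i)) (ws (suc i))

reverse-isPath : ∀ {X : Set} {R : Rel X 0ℓ} → Symmetric R →
                 ∀ {n} (ws : Fin (suc n) → X) → IsPath R ws → IsPath R (ws ∘ opposite)
reverse-isPath {R = R} R-sym ws steps i =
  subst (λ k → R (ws k) (ws (inject₁ (opposite i))))
        (sym (opposite-inject₁ i))
        (R-sym (steps (opposite i)))

module _ (M : Model) (φ : Formula) where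
  open Model M

  Eφ-sym : ∀ x → Symmetric (λ w u → Eφ M φ w u x)
  Eφ-sym (inj₁ s) {w} {u} e = Equivalence.to (E-sym w u s) e
  Eφ-sym (inj₂ G) {w} {u} (G∈A , a , a∈G , Ca⊆E) =
    G∈A , a , a∈G , λ s c → Equivalence.to (E-sym w u s) (Ca⊆E s c)

  Chain-sym : ∀ G → Symmetric (Chain M φ G)
  Chain-sym G (m , ws , ws₀≡w , wsₙ≡u , steps) =
    m , ws ∘ opposite , wsₙ≡u ,
    trans (cong ws (opposite-fromℕ (suc m))) ws₀≡w ,
    reverse-isPath (λ {w} {u} → Eφ-sym (inj₂ G) {w} {u}) ws steps

  E⁺φ-sym : ∀ x → Symmetric (λ w u → E⁺φ M φ w u x)
  E⁺φ-sym (inj₁ s) e                = Eφ-sym (inj₁ s) e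
  E⁺φ-sym (inj₂ G) (inj₁ e)         = inj₁ (Eφ-sym (inj₂ G) e)
  E⁺φ-sym (inj₂ G) (inj₂ (G∈A , c)) = inj₂ (G∈A , Chain-sym G c)

  E⁺φ-pos : ∀ w u → (∀ x → (E⁺φ M φ w u x ⇔ SA φ x)) → w ≡ u
  E⁺φ-pos w u full = E-pos w u (λ s → Equivalence.from (full (inj₁ s)) _)

proposition7 : (M : Model) (φ : Formula) →
    (∀ w u x → (E⁺φ M φ w u x ⇔ E⁺φ M φ u w x)) ×
    (∀ w u → (∀ x → (E⁺φ M φ w u x ⇔ SA φ x)) → w ≡ u)
proposition7 M φ =
  (λ w u x → mk⇔ (E⁺φ-sym M φ x) (E⁺φ-sym M φ x)) ,
  E⁺φ-pos M φ
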